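{- Let $G$ be an $n$-vertex graph with $\kappa(G)\ge\alpha(G)$. Then for every integer $r$ with $0\le r\le \frac{\kappa(G)-\alpha(G)}{2}$, there is some $\ell$ with $\ell-2(r+1)\le \max\left(\frac{n}{\kappa(G)-2r+1},\frac{n}{\kappa(G)-1}\right)$ such that $G$ contains $C^r_\ell$ as a subgraph. In particular, $G$ contains $P^r_{2r}$ as a subgraph for every such $r$.
   Context: All graphs are finite and simple. $\alpha(G)$ is the independence number of $G$; $\kappa(G)$ is the connectivity of $G$ (the minimum number of vertices whose removal makes $G$ disconnected or reduces it to a single vertex). For integers $\ell\ge 3$ and $r\ge 0$, $C^r_\ell$ (a "cycle of length $\ell$ with $r$ triangles") is the graph consisting of a cycle $v_1v_2\cdots v_\ell v_1$ together with the additional edges $v_1v_3, v_3v_5,\ldots,v_{2r-1}v_{2r+1}$ (for $r=0$ it is just the cycle of length $\ell$). Similarly $P^r_\ell$ (a "path of length $\ell$ with $r$ triangles") is the path $v_1v_2\cdots v_{\ell+1}$ of length $\ell$ (i.e. with $\ell$ edges) together with the additional edges $v_1v_3,v_3v_5,\ldots,v_{2r-1}v_{2r+1}$; $P^0_0$ is a single vertex. -}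

module Defs where

open import Data.Nat using (ℕ; zero; suc; _+_; _*_; _∸_; _≤_; _<_)
open import Data.Fin using (Fin; toℕ)
open import Data.Fin.Subset using (Subset; _∈_; _∉_; ∣_∣)
open import Data.Bool using (Bool; true; false)
open import Data.Product using (Σ; ∃; _×_; _,_)
open import Data.Sum using (_⊎_)
open import Relation.Binary.PropositionalEquality using (_≡_)
open import Relation.Nullary using (¬_)
open import Function.Definitions using (Injective)

record Graph (n : ℕ) : Set where
  field
    adj   : Fin n → Fin n → Bool
    sym   : ∀ i j → adj i j ≡ adj j i
    irref : ∀ i → adj i i ≡ false
open Graph public

Independent : ∀ {n} → Graph n → Subset n → Set
Independent G S = ∀ i j → i ∈ S → j ∈ S → adj G i j ≡ false

IsIndependenceNumber : ∀ {n} → Graph n → ℕ → Set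
IsIndependenceNumber G a =
  (Σ _ λ S → Independent G S × ∣ S ∣ ≡ a) ×
  (∀ S → Independent G S → ∣ S ∣ ≤ a)

data ReachAvoid {n} (G : Graph n) (S : Subset n) (u : Fin n) : Fin n → Set where
  here : u ∉ S → ReachAvoid G S u u
  step : ∀ {w v} → ReachAvoid G S u w → adj G w v ≡ true → v ∉ S → ReachAvoid G S u v

Separating : ∀ {n} → Graph n → Subset n → Set
Separating {n} G S =
  (n ∸ ∣ S ∣ ≤ 1) ⊎
  (Σ (Fin n) λ u → Σ (Fin n) λ v → u ∉ S × v ∉ S × ¬ ReachAvoid G S u v)

IsConnectivity : ∀ {n} → Graph n → ℕ → Set
IsConnectivity G k =
  (Σ _ λ S → Separating G S × ∣ S ∣ ≡ k) ×
  (∀ S → Separating G S → k ≤ ∣ S ∣)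

Contains : ∀ {n} → Graph n → (m : ℕ) → (Fin m → Fin m → Set) → Set
Contains {n} G m E =
  Σ (Fin m → Fin n) λ f → Injective _≡_ _≡_ f ×
    (∀ i j → E i j → adj G (f i) (f j) ≡ true)

-- Vertex v_{t+1} of the paper is index t here.
-- Triangle chords v_{2k+1} v_{2k+3} for k < r, i.e. indices 2k and 2k+2.
Chord : ℕ → ℕ → ℕ → Set
Chord r a b = Σ ℕ λ k → k < r × a ≡ 2 * k × b ≡ 2 * k + 2

CycleDirEdge : (ℓ r : ℕ) → Fin ℓ → Fin ℓ → Set
CycleDirEdge ℓ r i j =
  (toℕ j ≡ suc (toℕ i)) ⊎
  ((toℕ i ≡ 0 × suc (toℕ j) ≡ ℓ) ⊎ Chord r (toℕ i) (toℕ j))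

CycleEdge : (ℓ r : ℕ) → Fin ℓ → Fin ℓ → Set
CycleEdge ℓ r i j = CycleDirEdge ℓ r i j ⊎ CycleDirEdge ℓ r j i

ContainsCycleTri : ∀ {n} → Graph n → (ℓ r : ℕ) → Set
ContainsCycleTri G ℓ r = 3 ≤ ℓ × 2 * r + 1 ≤ ℓ × Contains G ℓ (CycleEdge ℓ r)

PathDirEdge : (ℓ r : ℕ) → Fin (suc ℓ) → Fin (suc ℓ) → Set
PathDirEdge ℓ r i j = (toℕ j ≡ suc (toℕ i)) ⊎ Chord r (toℕ i) (toℕ j)

PathEdge : (ℓ r : ℕ) → Fin (suc ℓ) → Fin (suc ℓ) → Set
PathEdge ℓ r i j = PathDirEdge ℓ r i j ⊎ PathDirEdge ℓ r j i

ContainsPathTri : ∀ {n} → Graph n → (ℓ r : ℕ) → Set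
ContainsPathTri G ℓ r = 2 * r ≤ ℓ × Contains G (suc ℓ) (PathEdge ℓ r)

-- Fix a vertex x₀. Every vertex has at least κ neighbours, so the free end z of a strip of r
-- triangles ending at x₀ has at least κ − 2r > α neighbours off the strip; two of them are adjacent
-- and give the next triangle. This builds P^r_{2r}. To close it into C^r_ℓ, let T be the strip
-- without its two ends and grow breadth-first balls B₀ ⊆ B₁ ⊆ … around the free end s in G − T
-- until they meet x₀. As long as x₀ ∉ B_{i+1}, the set T ∪ (B_{i+1} − B_i) separates B_i from x₀,
-- so every layer has at least κ − |T| = κ + 1 − 2r vertices, and the distance d from s to x₀
-- satisfies (d − 1)(κ − |T|) < n; a shortest path closes the cycle. For r = 0 the same search runs
-- in G − x₀ from a neighbour y of x₀ towards the other neighbours of x₀, of which there are at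
-- least κ − 1.
module Submission where

open import Defs hiding (sym)
open import Data.Nat using (ℕ; zero; suc; _+_; _*_; _∸_; _≤_; _<_; z≤n; s≤s; s≤s⁻¹)
open import Data.Nat.Properties hiding (_≟_)
open import Data.Fin using (Fin; zero; suc; toℕ; _≟_)
open import Data.Fin.Properties using (any?; toℕ-injective)
import Data.Fin.Properties as Finₚ
open import Data.Fin.Subset using (_∈_; _∉_; ∣_∣)
open import Data.Vec using (Vec; []; _∷_; head; lookup; _++_; tabulate)
open import Data.Vec.Properties using (lookup∘tabulate; []=⇒lookup; lookup⇒[]=)
open import Data.Vec.Relation.Unary.All as All using (All; []; _∷_)
import Data.Vec.Relation.Unary.All.Properties as All
open import Data.Vec.Relation.Unary.Linked using (Linked; [-]; _∷_)
open import Data.Vec.Relation.Unary.Unique.Propositional using (Unique)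
open import Data.Vec.Relation.Unary.Unique.Propositional.Properties using (lookup-injective)
open import Data.Vec.Relation.Unary.AllPairs as AllPairs using ([]; _∷_)
import Data.Vec.Relation.Unary.AllPairs.Properties as AllPairs
open import Data.Bool using (Bool; true; false; _∨_; _∧_; not)
open import Data.Bool.Properties
  using (∨-conicalˡ; ∨-conicalʳ; ∧-conicalˡ; ∧-conicalʳ; ∧-identityʳ; ¬-not; not-injective)
  renaming (_≟_ to _≟ᵇ_)
open import Data.Product using (Σ; ∃; ∃₂; _×_; _,_; proj₂)
open import Data.Sum using (_⊎_; inj₁; inj₂)
open import Relation.Binary.PropositionalEquality
open import Relation.Nullary using (¬_; yes; no; does; contradiction)
open import Relation.Nullary.Decidable using (dec-true; dec-false)
open import Function using (_∘_)

private
  variable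
    n m : ℕ

true≢false : true ≢ false
true≢false ()

∨-introˡ : ∀ {x y} → x ≡ true → x ∨ y ≡ true
∨-introˡ refl = refl

∨-introʳ : ∀ {x y} → y ≡ true → x ∨ y ≡ true
∨-introʳ {true} _ = refl
∨-introʳ {false} h = h

∨-resolveˡ : ∀ {x y} → x ≡ false → x ∨ y ≡ true → y ≡ true
∨-resolveˡ refl h = h

∧-falseˡ : ∀ {x y} → x ≡ false → x ∧ y ≡ false
∧-falseˡ refl = refl

∧-falseʳ : ∀ {x y} → y ≡ false → x ∧ y ≡ false
∧-falseʳ {true} h = h
∧-falseʳ {false} _ = refl

∧-resolveˡ : ∀ {x y} → x ≡ true → x ∧ y ≡ false → y ≡ false
∧-resolveˡ refl h = h

∧≡false : ∀ {x y} → (x ≡ true → y ≡ false) → x ∧ y ≡ false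
∧≡false {true} h = h refl
∧≡false {false} h = refl

FinSet : ℕ → Set
FinSet n = Fin n → Bool

infixr 7 _∩_
infixr 6 _∪_ _─_

_∪_ _∩_ _─_ : FinSet n → FinSet n → FinSet n
(X ∪ Y) i = X i ∨ Y i
(X ∩ Y) i = X i ∧ Y i
(X ─ Y) i = X i ∧ not (Y i)

∅ : FinSet n
∅ _ = false

⁅_⁆ : Fin n → FinSet n
⁅ e ⁆ i = does (i ≟ e)

_⊆_ : FinSet n → FinSet n → Set
X ⊆ Y = ∀ i → X i ≡ true → Y i ≡ true

Disjoint : FinSet n → FinSet n → Set
Disjoint X Y = ∀ i → (X ∩ Y) i ≡ false

size : FinSet n → ℕ
size {zero} X = 0
size {suc n} X with X zero
... | true = suc (size (X ∘ suc))
... | false = size (X ∘ suc)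

∈⁅⁆ : (e : Fin n) → ⁅ e ⁆ e ≡ true
∈⁅⁆ e = dec-true (e ≟ e) refl

∉⁅⁆ : {i e : Fin n} → i ≢ e → ⁅ e ⁆ i ≡ false
∉⁅⁆ {i = i} {e} = dec-false (i ≟ e)

⁅⁆⇒≡ : {i e : Fin n} → ⁅ e ⁆ i ≡ true → i ≡ e
⁅⁆⇒≡ {i = i} {e} h with i ≟ e
... | yes i≡e = i≡e

⁅⁆⇒≢ : {i e : Fin n} → ⁅ e ⁆ i ≡ false → i ≢ e
⁅⁆⇒≢ {e = e} h refl = true≢false (trans (sym (∈⁅⁆ e)) h)

∈∉⇒≢ : (X : FinSet n) {u v : Fin n} → X u ≡ true → X v ≡ false → u ≢ v
∈∉⇒≢ X u∈ v∉ refl = true≢false (trans (sym u∈) v∉)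

─-disjoint : (X Y : FinSet n) → Disjoint X (Y ─ X)
─-disjoint X Y i = ∧≡false {X i} λ Xi → ∧-falseʳ (cong not Xi)

size-cong : (X Y : FinSet n) → (∀ i → X i ≡ Y i) → size X ≡ size Y
size-cong {zero} X Y e = refl
size-cong {suc n} X Y e with X zero | Y zero | e zero
... | true  | true  | _ = cong suc (size-cong (X ∘ suc) (Y ∘ suc) (e ∘ suc))
... | false | false | _ = size-cong (X ∘ suc) (Y ∘ suc) (e ∘ suc)

size≤n : (X : FinSet n) → size X ≤ n
size≤n {zero} X = z≤n
size≤n {suc n} X with X zero
... | true = s≤s (size≤n (X ∘ suc))
... | false = m≤n⇒m≤1+n (size≤n (X ∘ suc))

size-full : (X : FinSet n) → (∀ i → X i ≡ true) → size X ≡ n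
size-full {zero} X h = refl
size-full {suc n} X h with X zero | h zero
... | true | _ = cong suc (size-full (X ∘ suc) (h ∘ suc))

size-empty : (X : FinSet n) → (∀ i → X i ≡ false) → size X ≡ 0
size-empty {zero} X h = refl
size-empty {suc n} X h with X zero | h zero
... | false | _ = size-empty (X ∘ suc) (h ∘ suc)

∈⇒size>0 : (X : FinSet n) (i : Fin n) → X i ≡ true → 0 < size X
∈⇒size>0 X zero h with X zero
... | true = s≤s z≤n
∈⇒size>0 X (suc i) h with X zero
... | true = s≤s z≤n
... | false = ∈⇒size>0 (X ∘ suc) i h

size>0⇒∈ : (X : FinSet n) → 0 < size X → ∃ λ i → X i ≡ true
size>0⇒∈ {suc n} X h with X zero in eq
... | true = zero , eq
... | false = let (i , Xi) = size>0⇒∈ (X ∘ suc) h in suc i , Xi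

size-∪+size-∩ : (X Y : FinSet n) → size X + size Y ≡ size (X ∪ Y) + size (X ∩ Y)
size-∪+size-∩ {zero} X Y = refl
size-∪+size-∩ {suc n} X Y with X zero | Y zero | size-∪+size-∩ (X ∘ suc) (Y ∘ suc)
... | true  | true  | ih = cong suc (trans (+-suc _ _) (trans (cong suc ih) (sym (+-suc _ _))))
... | true  | false | ih = cong suc ih
... | false | true  | ih = trans (+-suc _ _) (cong suc ih)
... | false | false | ih = ih

size-∪≤ : (X Y : FinSet n) → size (X ∪ Y) ≤ size X + size Y
size-∪≤ X Y = subst (size (X ∪ Y) ≤_) (sym (size-∪+size-∩ X Y)) (m≤m+n _ _)

size-disjoint-∪ : (X Y : FinSet n) → Disjoint X Y → size (X ∪ Y) ≡ size X + size Y
size-disjoint-∪ X Y h = begin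
  size (X ∪ Y)                  ≡⟨ +-identityʳ _ ⟨
  size (X ∪ Y) + 0              ≡⟨ cong (size (X ∪ Y) +_) (size-empty (X ∩ Y) h) ⟨
  size (X ∪ Y) + size (X ∩ Y)   ≡⟨ size-∪+size-∩ X Y ⟨
  size X + size Y               ∎
  where open ≡-Reasoning

size-∪ : (X Y : FinSet n) → size (X ∪ Y) ≡ size X + size (Y ─ X)
size-∪ X Y = trans (size-cong (X ∪ Y) (X ∪ (Y ─ X)) ∪≡∪─) (size-disjoint-∪ X (Y ─ X) (─-disjoint X Y))
  where
  ∪≡∪─ : ∀ i → (X ∪ Y) i ≡ (X ∪ (Y ─ X)) i
  ∪≡∪─ i with X i
  ... | true = refl
  ... | false = sym (∧-identityʳ (Y i))

size-─ : (X Y : FinSet n) → X ⊆ Y → size Y ≡ size X + size (Y ─ X)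
size-─ X Y X⊆Y = trans (size-cong Y (X ∪ Y) Y≡X∪Y) (size-∪ X Y)
  where
  Y≡X∪Y : ∀ i → Y i ≡ (X ∪ Y) i
  Y≡X∪Y i with X i in eq
  ... | true = X⊆Y i eq
  ... | false = refl

size-subsingleton : (X : FinSet n) → (∀ i j → X i ≡ true → X j ≡ true → i ≡ j) → size X ≤ 1
size-subsingleton {zero} X h = z≤n
size-subsingleton {suc n} X h with X zero in eq
... | true = s≤s (≤-reflexive (size-empty (X ∘ suc) rest-empty))
  where
  rest-empty : ∀ i → X (suc i) ≡ false
  rest-empty i = ¬-not λ Xi → contradiction (h zero (suc i) eq Xi) λ ()
... | false = size-subsingleton (X ∘ suc) λ i j Xi Xj → Finₚ.suc-injective (h (suc i) (suc j) Xi Xj)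

size-⁅⁆ : (e : Fin n) → size ⁅ e ⁆ ≤ 1
size-⁅⁆ e = size-subsingleton ⁅ e ⁆ λ i j i≡e j≡e → trans (⁅⁆⇒≡ i≡e) (sym (⁅⁆⇒≡ j≡e))

size-tabulate : (X : FinSet n) → ∣ tabulate X ∣ ≡ size X
size-tabulate {zero} X = refl
size-tabulate {suc n} X with X zero
... | true = cong suc (size-tabulate (X ∘ suc))
... | false = size-tabulate (X ∘ suc)

∈tabulate⇒ : (X : FinSet n) {i : Fin n} → i ∈ tabulate X → X i ≡ true
∈tabulate⇒ X {i} i∈ = trans (sym (lookup∘tabulate X i)) ([]=⇒lookup i∈)

∉tabulate⇒ : (X : FinSet n) {i : Fin n} → i ∉ tabulate X → X i ≡ false
∉tabulate⇒ X {i} i∉ = ¬-not λ Xi → i∉ (lookup⇒[]= i _ (trans (lookup∘tabulate X i) Xi))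

⇒∉tabulate : (X : FinSet n) {i : Fin n} → X i ≡ false → i ∉ tabulate X
⇒∉tabulate X Xi i∈ = true≢false (trans (sym (∈tabulate⇒ X i∈)) Xi)

anyᵇ : FinSet n → Bool
anyᵇ X = does (any? λ i → X i ≟ᵇ true)

anyᵇ-intro : (X : FinSet n) (i : Fin n) → X i ≡ true → anyᵇ X ≡ true
anyᵇ-intro X i Xi = dec-true (any? λ i → X i ≟ᵇ true) (i , Xi)

anyᵇ-elim : (X : FinSet n) → anyᵇ X ≡ true → ∃ λ i → X i ≡ true
anyᵇ-elim X h with any? (λ i → X i ≟ᵇ true)
... | yes witness = witness

anyᵇ-false : (X : FinSet n) → anyᵇ X ≡ false → ∀ i → X i ≡ false
anyᵇ-false X h i = ¬-not λ Xi → true≢false (trans (sym (anyᵇ-intro X i Xi)) h)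

elems : Vec (Fin n) m → FinSet n
elems [] = ∅
elems (x ∷ xs) = ⁅ x ⁆ ∪ elems xs

size-elems : (xs : Vec (Fin n) m) → size (elems xs) ≤ m
size-elems {n} [] = ≤-reflexive (size-empty {n} ∅ λ _ → refl)
size-elems (x ∷ xs) = ≤-trans (size-∪≤ ⁅ x ⁆ (elems xs)) (+-mono-≤ (size-⁅⁆ x) (size-elems xs))

∉elems⇒All≢ : {v : Fin n} (xs : Vec (Fin n) m) → elems xs v ≡ false → All (v ≢_) xs
∉elems⇒All≢ [] _ = []
∉elems⇒All≢ {v = v} (x ∷ xs) h =
  ⁅⁆⇒≢ (∨-conicalˡ _ _ h) ∷ ∉elems⇒All≢ xs (∨-conicalʳ (⁅ x ⁆ v) _ h)

All≢⇒∉elems : {v : Fin n} {xs : Vec (Fin n) m} → All (v ≢_) xs → elems xs v ≡ false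
All≢⇒∉elems [] = refl
All≢⇒∉elems (v≢x ∷ h) = cong₂ _∨_ (∉⁅⁆ v≢x) (All≢⇒∉elems h)

first-true : (h : ℕ → Bool) (N : ℕ) →
  (∀ j → j ≤ N → h j ≡ false) ⊎ (∃ λ D → h D ≡ true × (∀ j → j < D → h j ≡ false))
first-true h zero with h zero in eq
... | true = inj₂ (zero , eq , λ _ ())
... | false = inj₁ λ { zero _ → eq }
first-true h (suc N) with first-true h N
... | inj₂ found = inj₂ found
... | inj₁ none≤N with h (suc N) in eq
... | true = inj₂ (suc N , eq , λ j j<1+N → none≤N j (s≤s⁻¹ j<1+N))
... | false = inj₁ none≤1+N
  where
  none≤1+N : ∀ j → j ≤ suc N → h j ≡ false
  none≤1+N j j≤1+N with m≤n⇒m<n∨m≡n j≤1+N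
  ... | inj₁ j<1+N = none≤N j (s≤s⁻¹ j<1+N)
  ... | inj₂ refl = eq

toℕ≡2+ : (i : Fin (suc (suc m))) {x : ℕ} → toℕ i ≡ 2 + x → ∃ λ i′ → i ≡ suc (suc i′) × toℕ i′ ≡ x
toℕ≡2+ (suc (suc i)) refl = i , refl , refl

module GraphBasics {n : ℕ} (G : Graph n) where

  Adj : Fin n → Fin n → Set
  Adj u v = adj G u v ≡ true

  N : Fin n → FinSet n
  N = adj G

  adj-sym : ∀ {u v} → Adj u v → Adj v u
  adj-sym {u} {v} = trans (Graph.sym G v u)

  adj⇒≢ : ∀ {u v} → Adj u v → u ≢ v
  adj⇒≢ {u} h refl = true≢false (trans (sym h) (irref G u))

  data WalkTo (e : Fin n) : Vec (Fin n) (suc m) → Set where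
    [_] : ∀ {x} → Adj x e → WalkTo e (x ∷ [])
    _∷_ : ∀ {x y} {xs : Vec (Fin n) m} → Adj x y → WalkTo e (y ∷ xs) → WalkTo e (x ∷ y ∷ xs)

  Closed : FinSet n → FinSet n → Set
  Closed X I = ∀ {u v} → I u ≡ true → Adj u v → X v ≡ false → I v ≡ true

module Connectivity {n : ℕ} (G : Graph n) {k : ℕ} (min-sep : ∀ S → Separating G S → k ≤ ∣ S ∣) where
  open GraphBasics G

  closed-set-separates : (X I : FinSet n) {p w : Fin n} → Closed X I →
    I p ≡ true → X p ≡ false → I w ≡ false → X w ≡ false → k ≤ size X
  closed-set-separates X I {p} {w} closed Ip Xp Iw Xw =
    subst (k ≤_) (size-tabulate X)
      (min-sep (tabulate X) (inj₂ (p , w , ⇒∉tabulate X Xp , ⇒∉tabulate X Xw , unreachable)))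
    where
    reachable⇒I : ∀ {v} → ReachAvoid G (tabulate X) p v → I v ≡ true
    reachable⇒I (here _) = Ip
    reachable⇒I (step r uv v∉) = closed (reachable⇒I r) uv (∉tabulate⇒ X v∉)
    unreachable : ¬ ReachAvoid G (tabulate X) p w
    unreachable r = true≢false (trans (sym (reachable⇒I r)) Iw)

  size-∪-neighbourhood : (U : FinSet n) {e : Fin n} → U e ≡ false → k ≤ size (U ∪ N e)
  size-∪-neighbourhood U {e} Ue with any? (λ w → not (((U ∪ N e) ∪ ⁅ e ⁆) w) ≟ᵇ true)
  ... | yes (w , w∉) = closed-set-separates X ⁅ e ⁆ closed (∈⁅⁆ e) (cong₂ _∨_ Ue (irref G e))
                         (∨-conicalʳ (X w) _ (not-injective w∉)) (∨-conicalˡ _ _ (not-injective w∉))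
    where
    X = U ∪ N e
    closed : Closed X ⁅ e ⁆
    closed {u} {v} u≡e ev Xv with ⁅⁆⇒≡ {i = u} {e} u≡e
    ... | refl = contradiction (trans (sym (∨-introʳ {U v} ev)) Xv) true≢false
  ... | no none = subst (k ≤_) (size-tabulate X) (min-sep (tabulate X) (inj₁ few-left))
    where
    X = U ∪ N e
    covers : ∀ v → (X ∪ ⁅ e ⁆) v ≡ true
    covers v = ¬-not λ v∉ → none (v , cong not v∉)
    few-left : n ∸ ∣ tabulate X ∣ ≤ 1
    few-left = m≤n+o⇒m∸n≤o n _ (begin
      n                        ≡⟨ size-full (X ∪ ⁅ e ⁆) covers ⟨
      size (X ∪ ⁅ e ⁆)         ≤⟨ size-∪≤ X ⁅ e ⁆ ⟩
      size X + size ⁅ e ⁆      ≤⟨ +-monoʳ-≤ (size X) (size-⁅⁆ e) ⟩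
      size X + 1               ≡⟨ cong (_+ 1) (size-tabulate X) ⟨
      ∣ tabulate X ∣ + 1       ∎)
      where open ≤-Reasoning

module Balls {n : ℕ} (G : Graph n) {k : ℕ} (min-sep : ∀ S → Separating G S → k ≤ ∣ S ∣)
             (T : FinSet n) (p : Fin n) (p∉T : T p ≡ false) where
  open GraphBasics G
  open Connectivity G min-sep

  frontier : ℕ → FinSet n
  ball : ℕ → FinSet n
  frontier i v = not (T v) ∧ anyᵇ (λ u → ball i u ∧ adj G u v)
  ball zero = ⁅ p ⁆
  ball (suc i) = ball i ∪ frontier i

  ball⊆ball-suc : ∀ i → ball i ⊆ ball (suc i)
  ball⊆ball-suc i v = ∨-introˡ

  p∈ball : ∀ i → ball i p ≡ true
  p∈ball zero = ∈⁅⁆ p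
  p∈ball (suc i) = ∨-introˡ (p∈ball i)

  ball-avoids-T : ∀ i v → ball i v ≡ true → T v ≡ false
  ball-avoids-T zero v h with ⁅⁆⇒≡ {i = v} {p} h
  ... | refl = p∉T
  ball-avoids-T (suc i) v h with ball i v in eq
  ... | true = ball-avoids-T i v eq
  ... | false = not-injective (∧-conicalˡ _ _ h)

  ball-step : ∀ i {u v} → ball i u ≡ true → Adj u v → T v ≡ false → ball (suc i) v ≡ true
  ball-step i {u} {v} u∈ uv v∉T = ∨-introʳ {ball i v}
    (cong₂ _∧_ (cong not v∉T) (anyᵇ-intro (λ u → ball i u ∧ adj G u v) u (cong₂ _∧_ u∈ uv)))

  ball-parent : ∀ i v → ball (suc i) v ≡ true → ball i v ≡ false →
    T v ≡ false × ∃ λ u → ball i u ≡ true × Adj u v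
  ball-parent i v v∈ v∉ with ∨-resolveˡ v∉ v∈
  ... | new with anyᵇ-elim (λ u → ball i u ∧ adj G u v) (∧-conicalʳ _ _ new)
  ... | u , u∈ = not-injective (∧-conicalˡ _ _ new) , u , ∧-conicalˡ _ _ u∈ , ∧-conicalʳ _ _ u∈

  -- T together with the new layer separates ball i from w, whence the layer has ≥ k − |T| vertices.
  ball-grows : ∀ i {w} → T w ≡ false → ball (suc i) w ≡ false →
    k + size (ball i) ≤ size T + size (ball (suc i))
  ball-grows i {w} w∉T w∉ = begin
    k + size (ball i)                     ≤⟨ +-monoˡ-≤ (size (ball i)) k≤T∪layer ⟩
    size (T ∪ layer) + size (ball i)      ≡⟨ cong (_+ size (ball i)) (size-disjoint-∪ T layer T∩layer) ⟩
    size T + size layer + size (ball i)   ≡⟨ +-assoc (size T) _ _ ⟩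
    size T + (size layer + size (ball i)) ≡⟨ cong (size T +_) (+-comm (size layer) _) ⟩
    size T + (size (ball i) + size layer)
      ≡⟨ cong (size T +_) (size-─ (ball i) (ball (suc i)) (ball⊆ball-suc i)) ⟨
    size T + size (ball (suc i))          ∎
    where
    open ≤-Reasoning
    layer = ball (suc i) ─ ball i
    T∩layer : Disjoint T layer
    T∩layer v = ∧≡false {T v} λ v∈T →
      ∧-falseˡ (¬-not λ v∈ → true≢false (trans (sym v∈T) (ball-avoids-T (suc i) v v∈)))
    closed : Closed (T ∪ layer) (ball i)
    closed {u} {v} u∈ uv v∉ = not-injective
      (∧-resolveˡ (ball-step i u∈ uv (∨-conicalˡ _ _ v∉)) (∨-conicalʳ (T v) _ v∉))
    k≤T∪layer : k ≤ size (T ∪ layer)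
    k≤T∪layer = closed-set-separates (T ∪ layer) (ball i) closed (p∈ball i)
      (cong₂ _∨_ p∉T (∧-falseʳ (cong not (p∈ball i))))
      (¬-not λ w∈ → true≢false (trans (sym (ball⊆ball-suc i w w∈)) w∉))
      (cong₂ _∨_ w∉T (∧-falseˡ w∉))

  walk-back : ∀ j v → ball (suc j) v ≡ true → ball j v ≡ false →
    Σ (Vec (Fin n) j) λ Q → WalkTo p (v ∷ Q) × All (λ u → ball j u ≡ true) Q ×
                            All (_≢ p) (v ∷ Q) × Unique (v ∷ Q)
  walk-back zero v v∈ v∉ with ball-parent zero v v∈ v∉
  ... | _ , u , u∈ , uv with ⁅⁆⇒≡ {i = u} {p} u∈
  ... | refl = [] , [ adj-sym uv ] , [] , ⁅⁆⇒≢ v∉ ∷ [] , [] ∷ []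
  walk-back (suc j) v v∈ v∉ with ball-parent (suc j) v v∈ v∉
  ... | v∉T , u , u∈ , uv
      with walk-back j u u∈ (¬-not λ u∈′ → ∈∉⇒≢ (ball (suc j)) (ball-step j u∈′ uv v∉T) v∉ refl)
  ... | Q , walk , Q∈ , avoids-p , unique =
    u ∷ Q , adj-sym uv ∷ walk , uQ∈ , ∈∉⇒≢ (ball (suc j)) (p∈ball (suc j)) v∉ ∘ sym ∷ avoids-p ,
    All.map (λ x∈ → ∈∉⇒≢ (ball (suc j)) x∈ v∉ ∘ sym) uQ∈ ∷ unique
    where
    uQ∈ : All (λ x → ball (suc j) x ≡ true) (u ∷ Q)
    uQ∈ = u∈ ∷ All.map (ball⊆ball-suc j _) Q∈

  module _ (W : FinSet n) (p∉W : W p ≡ false) (W⇒∉T : ∀ v → W v ≡ true → T v ≡ false)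
           {w₀ : Fin n} (w₀∈W : W w₀ ≡ true) (T<k : size T < k) where

    hits : ℕ → Bool
    hits i = anyᵇ (W ∩ ball i)

    miss⇒∉ball : ∀ i {v} → hits i ≡ false → W v ≡ true → ball i v ≡ false
    miss⇒∉ball i {v} h Wv = ∧-resolveˡ Wv (anyᵇ-false (W ∩ ball i) h v)

    misses-at-0 : hits 0 ≡ false
    misses-at-0 = ¬-not λ h → let (v , v∈) = anyᵇ-elim (W ∩ ball 0) h in
      ∈∉⇒≢ W (∧-conicalˡ _ _ v∈) p∉W (⁅⁆⇒≡ {i = v} {p} (∧-conicalʳ _ _ v∈))

    c : ℕ
    c = k ∸ size T

    ball-size : ∀ i → (∀ j → j ≤ i → hits j ≡ false) → i * c + 1 ≤ size (ball i)
    ball-size zero _ = ∈⇒size>0 (ball zero) p (∈⁅⁆ p)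
    ball-size (suc i) misses = begin
      suc i * c + 1         ≡⟨ +-assoc c (i * c) 1 ⟩
      c + (i * c + 1)       ≤⟨ +-monoʳ-≤ c (ball-size i λ j j≤i → misses j (m≤n⇒m≤1+n j≤i)) ⟩
      c + size (ball i)     ≤⟨ +-cancelˡ-≤ (size T) _ _ grows ⟩
      size (ball (suc i))   ∎
      where
      open ≤-Reasoning
      grows : size T + (c + size (ball i)) ≤ size T + size (ball (suc i))
      grows = begin
        size T + (c + size (ball i))   ≡⟨ +-assoc (size T) c _ ⟨
        size T + c + size (ball i)     ≡⟨ cong (_+ size (ball i)) (m+[n∸m]≡n (<⇒≤ T<k)) ⟩
        k + size (ball i)
          ≤⟨ ball-grows i (W⇒∉T w₀ w₀∈W) (miss⇒∉ball (suc i) (misses (suc i) ≤-refl) w₀∈W) ⟩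
        size T + size (ball (suc i))   ∎

    eventually-hits : ¬ (∀ j → j ≤ n → hits j ≡ false)
    eventually-hits misses = <⇒≱ (s≤s n≤n*c) (begin
      suc (n * c)       ≡⟨ +-comm 1 (n * c) ⟩
      n * c + 1         ≤⟨ ball-size n misses ⟩
      size (ball n)     ≤⟨ size≤n (ball n) ⟩
      n                 ∎)
      where
      open ≤-Reasoning
      n≤n*c : n ≤ n * c
      n≤n*c = ≤-trans (≤-reflexive (sym (*-identityʳ n))) (*-monoʳ-≤ n (m<n⇒0<n∸m T<k))

    record ShortWalk : Set where
      field
        len           : ℕ
        start         : Fin n
        rest          : Vec (Fin n) len
        start∈W       : W start ≡ true
        walk          : WalkTo p (start ∷ rest)
        avoids-T      : All (λ u → T u ≡ false) (start ∷ rest)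
        rest-avoids-W : All (λ u → W u ≡ false) rest
        avoids-p      : All (_≢ p) (start ∷ rest)
        unique        : Unique (start ∷ rest)
        short         : len * c + size W ≤ n

    walk-from-first-hit : ∀ D → hits (suc D) ≡ true → (∀ j → j ≤ D → hits j ≡ false) → ShortWalk
    walk-from-first-hit D hit misses with anyᵇ-elim (W ∩ ball (suc D)) hit
    ... | w , w∈
        with walk-back D w (∧-conicalʳ _ _ w∈) (miss⇒∉ball D (misses D ≤-refl) (∧-conicalˡ _ _ w∈))
    ... | Q , walk , Q∈ , avoids-p , unique = record
      { len = D ; start = w ; rest = Q ; start∈W = ∧-conicalˡ _ _ w∈ ; walk = walk
      ; avoids-T = ball-avoids-T (suc D) w (∧-conicalʳ _ _ w∈) ∷ All.map (ball-avoids-T D _) Q∈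
      ; rest-avoids-W = All.map (λ u∈ → ¬-not λ Wu → ∈∉⇒≢ (ball D) u∈ (W∉ball Wu) refl) Q∈
      ; avoids-p = avoids-p ; unique = unique
      ; short = begin
          D * c + size W         ≤⟨ +-monoˡ-≤ (size W) (≤-trans (m≤m+n (D * c) 1) (ball-size D misses)) ⟩
          size (ball D) + size W ≡⟨ size-disjoint-∪ (ball D) W ball∩W ⟨
          size (ball D ∪ W)      ≤⟨ size≤n (ball D ∪ W) ⟩
          n                      ∎ }
      where
      open ≤-Reasoning
      W∉ball : ∀ {v} → W v ≡ true → ball D v ≡ false
      W∉ball = miss⇒∉ball D (misses D ≤-refl)
      ball∩W : Disjoint (ball D) W
      ball∩W v = ∧≡false {ball D v} λ v∈ → ¬-not λ Wv → ∈∉⇒≢ (ball D) v∈ (W∉ball Wv) refl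

    shortest-walk : ShortWalk
    shortest-walk with first-true hits n
    ... | inj₁ misses = contradiction misses eventually-hits
    ... | inj₂ (zero , hit , _) = contradiction (trans (sym hit) misses-at-0) λ ()
    ... | inj₂ (suc D , hit , before) = walk-from-first-hit D hit λ j j≤D → before j (s≤s j≤D)
module Embeddings {n : ℕ} (G : Graph n) where
  open GraphBasics G

  data Chords : ℕ → Vec (Fin n) m → Set where
    none  : {xs : Vec (Fin n) m} → Chords 0 xs
    chord : ∀ {r a b c} {xs : Vec (Fin n) m} →
            Adj a c → Chords r (c ∷ xs) → Chords (suc r) (a ∷ b ∷ c ∷ xs)

  chords-++ : ∀ {r m′} {C : Vec (Fin n) m} → Chords r C → (M : Vec (Fin n) m′) → Chords r (C ++ M)
  chords-++ none M = none
  chords-++ (chord ac ch) M = chord ac (chords-++ ch M)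

  linked-lookup : {C : Vec (Fin n) m} → Linked Adj C →
    ∀ i j → toℕ j ≡ suc (toℕ i) → Adj (lookup C i) (lookup C j)
  linked-lookup {C = _ ∷ _ ∷ _} (xy ∷ _) zero (suc zero) _ = xy
  linked-lookup (_ ∷ l) (suc i) (suc j) e = linked-lookup l i j (suc-injective e)

  walkTo-lookup : ∀ {e} {C : Vec (Fin n) (suc m)} → WalkTo e C →
    ∀ i j → toℕ j ≡ suc (toℕ i) → Adj (lookup C i) (lookup C j)
  walkTo-lookup (xy ∷ _) zero (suc zero) _ = xy
  walkTo-lookup (_ ∷ w) (suc i) (suc j) e = walkTo-lookup w i j (suc-injective e)

  walkTo-last : ∀ {e} {C : Vec (Fin n) (suc m)} → WalkTo e C →
    ∀ j → suc (toℕ j) ≡ suc m → Adj (lookup C j) e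
  walkTo-last [ xe ] zero _ = xe
  walkTo-last (_ ∷ w) (suc j) e = walkTo-last w j (suc-injective e)

  chords-lookup : ∀ {r} {C : Vec (Fin n) m} → Chords r C →
    ∀ i j → Chord r (toℕ i) (toℕ j) → Adj (lookup C i) (lookup C j)
  chords-lookup none i j (_ , () , _)
  chords-lookup (chord ac _) i j (zero , _ , i≡0 , j≡2)
    with toℕ-injective {i = i} {zero} i≡0 | toℕ≡2+ j j≡2
  ... | refl | j′ , refl , j′≡0 with toℕ-injective {i = j′} {zero} j′≡0
  ... | refl = ac
  chords-lookup (chord _ ch) i j (suc q , q<r , i≡ , j≡)
    with toℕ≡2+ i (trans i≡ (*-suc 2 q)) | toℕ≡2+ j (trans j≡ (cong (_+ 2) (*-suc 2 q)))
  ... | i′ , refl , i′≡ | j′ , refl , j′≡ = chords-lookup ch i′ j′ (q , s≤s⁻¹ q<r , i′≡ , j′≡)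

  cycle-embedding : ∀ {ℓ r} (C : Vec (Fin n) (suc ℓ)) → WalkTo (head C) C → Chords r C → Unique C →
    Contains G (suc ℓ) (CycleEdge (suc ℓ) r)
  cycle-embedding {ℓ} {r} C@(c ∷ _) walk chords unique =
    lookup C , (λ {i} {j} → lookup-injective unique i j) , edge
    where
    directed : ∀ i j → CycleDirEdge (suc ℓ) r i j → Adj (lookup C i) (lookup C j)
    directed i j (inj₁ j≡1+i) = walkTo-lookup walk i j j≡1+i
    directed i j (inj₂ (inj₁ (i≡0 , j-last))) with toℕ-injective {i = i} {zero} i≡0
    ... | refl = adj-sym (walkTo-last walk j j-last)
    directed i j (inj₂ (inj₂ ch)) = chords-lookup chords i j ch
    edge : ∀ i j → CycleEdge (suc ℓ) r i j → Adj (lookup C i) (lookup C j)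
    edge i j (inj₁ ij) = directed i j ij
    edge i j (inj₂ ji) = adj-sym (directed j i ji)

  path-embedding : ∀ {ℓ r} (S : Vec (Fin n) (suc ℓ)) → Linked Adj S → Chords r S → Unique S →
    Contains G (suc ℓ) (PathEdge ℓ r)
  path-embedding {ℓ} {r} S path chords unique =
    lookup S , (λ {i} {j} → lookup-injective unique i j) , edge
    where
    directed : ∀ i j → PathDirEdge ℓ r i j → Adj (lookup S i) (lookup S j)
    directed i j (inj₁ j≡1+i) = linked-lookup path i j j≡1+i
    directed i j (inj₂ ch) = chords-lookup chords i j ch
    edge : ∀ i j → PathEdge ℓ r i j → Adj (lookup S i) (lookup S j)
    edge i j (inj₁ ij) = directed i j ij
    edge i j (inj₂ ji) = adj-sym (directed j i ji)

  walkTo-snoc : ∀ {e h} {Q : Vec (Fin n) (suc m)} → WalkTo e Q → Adj e h → WalkTo h (Q ++ e ∷ [])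
  walkTo-snoc [ xe ] eh = xe ∷ [ eh ]
  walkTo-snoc (xy ∷ w) eh = xy ∷ walkTo-snoc w eh

  -- Read from the front, S is the vertex sequence v₁ v₂ … v_{2r+1} = e of a copy of P^r_{2r}.
  data Strip (e : Fin n) : ℕ → Vec (Fin n) (suc m) → Set where
    end      : Strip e 0 (e ∷ [])
    triangle : ∀ {r x y z} {xs : Vec (Fin n) m} → Adj y x → Adj x z → Adj y z →
               Strip e r (z ∷ xs) → Strip e (suc r) (y ∷ x ∷ z ∷ xs)

  strip⇒linked : ∀ {e r} {S : Vec (Fin n) (suc m)} → Strip e r S → Linked Adj S
  strip⇒linked end = [-]
  strip⇒linked (triangle yx xz _ s) = yx ∷ xz ∷ strip⇒linked s

  strip⇒chords : ∀ {e r} {S : Vec (Fin n) (suc m)} → Strip e r S → Chords r S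
  strip⇒chords end = none
  strip⇒chords (triangle _ _ yz s) = chord yz (strip⇒chords s)

  strip-++-walkTo : ∀ {e r h m′} {S : Vec (Fin n) (suc m)} {M : Vec (Fin n) m′} →
    Strip e r S → WalkTo h (e ∷ M) → WalkTo h (S ++ M)
  strip-++-walkTo end w = w
  strip-++-walkTo (triangle yx xz _ s) w = yx ∷ xz ∷ strip-++-walkTo s w

  strip∋end : ∀ {e r} {S : Vec (Fin n) (suc m)} → Strip e r S → elems S e ≡ true
  strip∋end {e = e} end = ∨-introˡ (∈⁅⁆ e)
  strip∋end {e = e} (triangle {x = x} {y} _ _ _ s) =
    ∨-introʳ {⁅ y ⁆ e} (∨-introʳ {⁅ x ⁆ e} (strip∋end s))

  strip-tail∋end : ∀ {e r s} {S : Vec (Fin n) (suc m)} → Strip e (suc r) (s ∷ S) → elems S e ≡ true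
  strip-tail∋end {e = e} (triangle {x = x} _ _ _ s) = ∨-introʳ {⁅ x ⁆ e} (strip∋end s)

large-set-has-edge : ∀ {n} (G : Graph n) {a : ℕ} → (∀ S → Independent G S → ∣ S ∣ ≤ a) →
  (Y : FinSet n) → a < size Y → ∃₂ λ x y → Y x ≡ true × Y y ≡ true × adj G x y ≡ true
large-set-has-edge G α-max Y a<Y with any? (λ x → anyᵇ (λ y → Y x ∧ Y y ∧ adj G x y) ≟ᵇ true)
... | yes (x , h) with anyᵇ-elim (λ y → Y x ∧ Y y ∧ adj G x y) h
... | y , xy = x , y , ∧-conicalˡ (Y x) _ xy , ∧-conicalˡ (Y y) _ (∧-conicalʳ (Y x) _ xy) ,
                ∧-conicalʳ (Y y) _ (∧-conicalʳ (Y x) _ xy)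
large-set-has-edge G α-max Y a<Y | no none =
  contradiction (subst (_≤ _) (size-tabulate Y) (α-max (tabulate Y) independent)) (<⇒≱ a<Y)
  where
  independent : Independent G (tabulate Y)
  independent i j i∈ j∈ = ∧-resolveˡ (∈tabulate⇒ Y j∈) (∧-resolveˡ (∈tabulate⇒ Y i∈)
    (anyᵇ-false (λ y → Y i ∧ Y y ∧ adj G i y) (¬-not λ h → none (i , h)) j))

module StripConstruction {n : ℕ} (G : Graph n) {k : ℕ} (min-sep : ∀ S → Separating G S → k ≤ ∣ S ∣)
                         {a : ℕ} (α-max : ∀ S → Independent G S → ∣ S ∣ ≤ a) (x₀ : Fin n) where
  open GraphBasics G
  open Connectivity G min-sep
  open Embeddings G

  StripFrom : ℕ → Set
  StripFrom r = Σ (Vec (Fin n) (suc (2 * r))) λ S → Strip x₀ r S × Unique S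

  extend-strip : ∀ {r z} {xs : Vec (Fin n) (2 * r)} → Strip x₀ r (z ∷ xs) → Unique (z ∷ xs) →
    2 * suc r + a ≤ k → Σ (Vec (Fin n) (3 + 2 * r)) λ S → Strip x₀ (suc r) S × Unique S
  extend-strip {r} {z} {xs} strip unique@(z∉xs ∷ _) r+1≤ with large-set-has-edge G α-max Y a<Y
    where
    Y = N z ─ elems xs
    a<Y : a < size Y
    a<Y = +-cancelˡ-≤ (2 * r) _ _ (begin
      2 * r + suc a                  ≡⟨ +-suc (2 * r) a ⟩
      suc (2 * r + a)                ≤⟨ n≤1+n _ ⟩
      2 + 2 * r + a                  ≡⟨ cong (_+ a) (*-suc 2 r) ⟨
      2 * suc r + a                  ≤⟨ r+1≤ ⟩
      k                              ≤⟨ size-∪-neighbourhood (elems xs) (All≢⇒∉elems z∉xs) ⟩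
      size (elems xs ∪ N z)          ≡⟨ size-∪ (elems xs) (N z) ⟩
      size (elems xs) + size Y       ≤⟨ +-monoˡ-≤ (size Y) (size-elems xs) ⟩
      2 * r + size Y                 ∎)
      where open ≤-Reasoning
  ... | x , y , x∈Y , y∈Y , xy =
    y ∷ x ∷ z ∷ xs , triangle (adj-sym xy) (adj-sym zx) (adj-sym zy) strip ,
    (adj⇒≢ xy ∘ sym ∷ adj⇒≢ zy ∘ sym ∷ ∉elems⇒All≢ xs (not-injective (∧-conicalʳ _ _ y∈Y))) ∷
    (adj⇒≢ zx ∘ sym ∷ ∉elems⇒All≢ xs (not-injective (∧-conicalʳ _ _ x∈Y))) ∷ unique
    where
    zx = ∧-conicalˡ _ _ x∈Y
    zy = ∧-conicalˡ _ _ y∈Y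

  build-strip : ∀ r → 2 * r + a ≤ k → StripFrom r
  build-strip zero _ = x₀ ∷ [] , end , [] ∷ []
  build-strip (suc r) r+1≤ with build-strip r (≤-trans (+-monoˡ-≤ a (*-monoʳ-≤ 2 (n≤1+n r))) r+1≤)
  ... | _ ∷ _ , strip , unique =
    subst (λ m → Σ (Vec (Fin n) (suc m)) λ S → Strip x₀ (suc r) S × Unique S) (sym (*-suc 2 r))
      (extend-strip strip unique r+1≤)

module Cycles {n : ℕ} (G : Graph n) {k : ℕ} (min-sep : ∀ S → Separating G S → k ≤ ∣ S ∣) where
  open GraphBasics G
  open Connectivity G min-sep
  open Embeddings G

  ShortCycle : ℕ → Set
  ShortCycle r = Σ ℕ λ ℓ → ContainsCycleTri G ℓ r ×
    ((ℓ ∸ 2 * (r + 1)) * (suc k ∸ 2 * r) ≤ n ⊎ (ℓ ∸ 2 * (r + 1)) * (k ∸ 1) ≤ n)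

  cycle-through-edge : ∀ {x₀ y} → Adj x₀ y → 2 ≤ k → ShortCycle 0
  cycle-through-edge {x₀} {y} x₀y 2≤k =
    suc (suc (len + 1)) , (s≤s (s≤s (m≤n+m 1 len)) , s≤s z≤n , cycle-embedding C walkC none uniqueC) ,
    inj₂ bound
    where
    T = ⁅ x₀ ⁆
    W = N x₀ ─ ⁅ y ⁆
    y∉T : T y ≡ false
    y∉T = ∉⁅⁆ (adj⇒≢ x₀y ∘ sym)
    y∉W : W y ≡ false
    y∉W = ∧-falseʳ (cong not (∈⁅⁆ y))
    W⇒∉T : ∀ v → W v ≡ true → T v ≡ false
    W⇒∉T v v∈W = ∉⁅⁆ (adj⇒≢ (∧-conicalˡ _ _ v∈W) ∘ sym)
    k≤1+W : k ≤ 1 + size W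
    k≤1+W = begin
      k                       ≤⟨ size-∪-neighbourhood ⁅ y ⁆ (∉⁅⁆ (adj⇒≢ x₀y)) ⟩
      size (⁅ y ⁆ ∪ N x₀)     ≡⟨ size-∪ ⁅ y ⁆ (N x₀) ⟩
      size ⁅ y ⁆ + size W     ≤⟨ +-monoˡ-≤ (size W) (size-⁅⁆ y) ⟩
      1 + size W              ∎
      where open ≤-Reasoning
    w₀ = size>0⇒∈ W (+-cancelˡ-≤ 1 _ _ (≤-trans 2≤k k≤1+W))
    T<k : size T < k
    T<k = ≤-trans (s≤s (size-⁅⁆ x₀)) 2≤k
    open Balls G min-sep T y y∉T
    open ShortWalk (shortest-walk W y∉W W⇒∉T (proj₂ w₀) T<k)
    C = x₀ ∷ (start ∷ rest) ++ y ∷ []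
    walkC : WalkTo x₀ C
    walkC = ∧-conicalˡ _ _ start∈W ∷ walkTo-snoc walk (adj-sym x₀y)
    uniqueC : Unique C
    uniqueC = All.++⁺ (All.map (λ u∉T → ⁅⁆⇒≢ u∉T ∘ sym) avoids-T) (adj⇒≢ x₀y ∷ []) ∷
              AllPairs.++⁺ unique ([] ∷ []) (All.map (_∷ []) avoids-p)
    bound : (len + 1) * (k ∸ 1) ≤ n
    bound = begin
      (len + 1) * (k ∸ 1)              ≡⟨ *-distribʳ-+ (k ∸ 1) len 1 ⟩
      len * (k ∸ 1) + 1 * (k ∸ 1)      ≡⟨ cong (len * (k ∸ 1) +_) (*-identityˡ (k ∸ 1)) ⟩
      len * (k ∸ 1) + (k ∸ 1)          ≤⟨ +-mono-≤ (*-monoʳ-≤ len (∸-monoʳ-≤ k (size-⁅⁆ x₀)))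
                                                   (m≤n+o⇒m∸n≤o k 1 k≤1+W) ⟩
      len * (k ∸ size T) + size W      ≤⟨ short ⟩
      n                                ∎
      where open ≤-Reasoning

  cycle-around-strip : ∀ {r x₀ s} {S : Vec (Fin n) (2 * suc r)} →
    Strip x₀ (suc r) (s ∷ S) → Unique (s ∷ S) → 2 * suc r ≤ k → ShortCycle (suc r)
  cycle-around-strip {r} {x₀} {s} {S} strip (s∉S ∷ uniqueS) 2r≤k =
    suc (2 * r′) + len , (3≤ℓ , 2r+1≤ℓ , cycle-embedding C walkC chordsC uniqueC) , inj₁ bound
    where
    r′ = suc r
    T = elems S ─ ⁅ x₀ ⁆
    W = ⁅ x₀ ⁆
    x₀∈S : elems S x₀ ≡ true
    x₀∈S = strip-tail∋end strip
    W⊆S : W ⊆ elems S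
    W⊆S v v∈W with ⁅⁆⇒≡ {i = v} {x₀} v∈W
    ... | refl = x₀∈S
    s∉elems : elems S s ≡ false
    s∉elems = All≢⇒∉elems s∉S
    s∉T : T s ≡ false
    s∉T = ∧-falseˡ s∉elems
    s∉W : W s ≡ false
    s∉W = ∉⁅⁆ (∈∉⇒≢ (elems S) x₀∈S s∉elems ∘ sym)
    W⇒∉T : ∀ v → W v ≡ true → T v ≡ false
    W⇒∉T v v∈W with ⁅⁆⇒≡ {i = v} {x₀} v∈W
    ... | refl = ∧-falseʳ (cong not (∈⁅⁆ x₀))
    T<2r : size T < 2 * r′
    T<2r = begin-strict
      size T                       <⟨ m<n+m (size T) (∈⇒size>0 W x₀ (∈⁅⁆ x₀)) ⟩
      size W + size T              ≡⟨ size-─ W (elems S) W⊆S ⟨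
      size (elems S)               ≤⟨ size-elems S ⟩
      2 * r′                       ∎
      where open ≤-Reasoning
    open Balls G min-sep T s s∉T
    open ShortWalk (shortest-walk W s∉W W⇒∉T {x₀} (∈⁅⁆ x₀) (<-≤-trans T<2r 2r≤k))
    C = (s ∷ S) ++ rest
    walkC : WalkTo s C
    walkC = strip-++-walkTo strip (subst (λ v → WalkTo s (v ∷ rest)) (⁅⁆⇒≡ start∈W) walk)
    chordsC : Chords r′ C
    chordsC = chords-++ (strip⇒chords strip) rest
    outside-strip : ∀ {u} → (T u ≡ false × W u ≡ false) × u ≢ s → All (_≢ u) (s ∷ S)
    outside-strip {u} ((u∉T , u∉W) , u≢s) =
      All.map (_∘ sym) (∉elems⇒All≢ (s ∷ S) (cong₂ _∨_ (∉⁅⁆ u≢s) u∉S))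
      where
      u∉S : elems S u ≡ false
      u∉S = trans (sym (∧-identityʳ (elems S u))) (subst (λ b → elems S u ∧ not b ≡ false) u∉W u∉T)
    rest-outside-strip : All (λ u → All (_≢ u) (s ∷ S)) rest
    rest-outside-strip =
      All.map outside-strip (All.zip (All.zip (All.tail avoids-T , rest-avoids-W) , All.tail avoids-p))
    uniqueC : Unique C
    uniqueC = AllPairs.++⁺ (s∉S ∷ uniqueS) (AllPairs.tail unique) (All.All-swap rest-outside-strip)
    3≤ℓ : 3 ≤ suc (2 * r′) + len
    3≤ℓ = ≤-trans (s≤s (*-monoʳ-≤ 2 (s≤s (z≤n {r})))) (m≤m+n (suc (2 * r′)) len)
    2r+1≤ℓ : 2 * r′ + 1 ≤ suc (2 * r′) + len
    2r+1≤ℓ = ≤-trans (≤-reflexive (+-comm (2 * r′) 1)) (m≤m+n (suc (2 * r′)) len)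
    ℓ-2r-2≤len : suc (2 * r′) + len ∸ 2 * (r′ + 1) ≤ len
    ℓ-2r-2≤len = m≤n+o⇒m∸n≤o _ (2 * (r′ + 1)) (+-monoˡ-≤ len (begin
      suc (2 * r′)          ≤⟨ n≤1+n _ ⟩
      2 + 2 * r′            ≡⟨ +-comm 2 (2 * r′) ⟩
      2 * r′ + 2            ≡⟨ *-distribˡ-+ 2 r′ 1 ⟨
      2 * (r′ + 1)          ∎))
      where open ≤-Reasoning
    bound : (suc (2 * r′) + len ∸ 2 * (r′ + 1)) * (suc k ∸ 2 * r′) ≤ n
    bound = begin
      (suc (2 * r′) + len ∸ 2 * (r′ + 1)) * (suc k ∸ 2 * r′)
        ≤⟨ *-mono-≤ ℓ-2r-2≤len (∸-monoʳ-≤ (suc k) T<2r) ⟩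
      len * (k ∸ size T)           ≤⟨ m≤m+n _ (size W) ⟩
      len * (k ∸ size T) + size W  ≤⟨ short ⟩
      n                            ∎
      where open ≤-Reasoning

lemma2p4 : (n : ℕ) (G : Graph n) (a k : ℕ) →
    IsIndependenceNumber G a → IsConnectivity G k →
    a ≤ k → 2 ≤ k →
    (r : ℕ) → 2 * r + a ≤ k →
      (Σ ℕ λ ℓ → ContainsCycleTri G ℓ r ×
        ((ℓ ∸ 2 * (r + 1)) * (suc k ∸ 2 * r) ≤ n ⊎ (ℓ ∸ 2 * (r + 1)) * (k ∸ 1) ≤ n))
      × ContainsPathTri G (2 * r) r
lemma2p4 zero G a k _ (_ , min-sep) _ 2≤k r _ = contradiction (≤-trans 2≤k (min-sep [] (inj₁ z≤n))) λ ()
lemma2p4 (suc n) G a k (_ , α-max) (_ , min-sep) _ 2≤k r 2r+a≤k = cycle r 2r+a≤k , path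
  where
  open GraphBasics G
  open Connectivity G min-sep
  open Embeddings G
  open StripConstruction G min-sep α-max zero
  open Cycles G min-sep
  cycle : ∀ r → 2 * r + a ≤ k → ShortCycle r
  cycle zero _ with size>0⇒∈ (N zero) (≤-trans (s≤s z≤n) (≤-trans 2≤k (size-∪-neighbourhood ∅ refl)))
  ... | y , x₀y = cycle-through-edge x₀y 2≤k
  cycle (suc r) 2r+a≤k with build-strip (suc r) 2r+a≤k
  ... | s ∷ S , strip , unique = cycle-around-strip strip unique (≤-trans (m≤m+n _ a) 2r+a≤k)
  path : ContainsPathTri G (2 * r) r
  path with build-strip r 2r+a≤k
  ... | S , strip , unique = ≤-refl , path-embedding S (strip⇒linked strip) (strip⇒chords strip) unique
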